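{- Let $G$ be a graph of order $n\geq 2$ which has a Hamiltonian path. Then \[ \lfloor 2n/3 \rfloor +1\leq \chi_d^t(C(G))\leq n+ \lceil n/2 \rceil . \]
   Context: All graphs are finite, simple and undirected. For a graph $G=(V,E)$ with $V=\{v_1,\dots,v_n\}$, the central graph $C(G)$ is the graph with vertex set $V\cup\{c_{ij} : v_iv_j\in E\}$ obtained by subdividing each edge $v_iv_j$ of $G$ exactly once by a new vertex $c_{ij}$ (adjacent to exactly $v_i$ and $v_j$) and joining every pair of distinct vertices non-adjacent in $G$. A total dominator coloring (TDC) of a graph $H$ with no isolated vertices is a proper vertex coloring of $H$ in which every vertex is adjacent to all vertices of some color class. $\chi_d^t(H)$ is the minimum number of color classes in a TDC of $H$. -}

module Defs where

open import Data.Bool using (Bool; true; false; T)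
open import Data.Nat using (ℕ; _<_)
open import Data.Fin using (Fin; toℕ)
open import Data.Product using (Σ; ∃; _×_; _,_)
open import Data.Sum using (_⊎_; inj₁; inj₂)
open import Data.Empty using (⊥)
open import Relation.Nullary using (¬_)
open import Relation.Binary.PropositionalEquality using (_≡_; _≢_)
open import Function.Definitions using (Injective; Surjective)

-- A finite simple graph on vertex set Fin n, with Boolean adjacency
-- (so that "u and v are adjacent" is a proposition).
record Graph (n : ℕ) : Set where
  field
    adj     : Fin n → Fin n → Bool
    adj-sym : ∀ u v → adj u v ≡ adj v u
    irrefl  : ∀ u → adj u u ≡ false

open Graph public

Adj : ∀ {n} → Graph n → Fin n → Fin n → Set
Adj G u v = T (adj G u v)

HasHamiltonianPath : ∀ {n} → Graph n → Set
HasHamiltonianPath {n} G =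
  Σ (Fin n → Fin n) λ p →
    Injective _≡_ _≡_ p ×
    (∀ i j → toℕ j ≡ Data.Nat.suc (toℕ i) → Adj G (p i) (p j))

-- Edges of G, one vertex c_ij per edge v_i v_j with i < j.
EdgeOf : ∀ {n} → Graph n → Set
EdgeOf {n} G = Σ (Fin n) λ i → Σ (Fin n) λ j → (toℕ i < toℕ j) × Adj G i j

-- Vertex set of the central graph C(G): original vertices ⊎ subdivision vertices.
CVertex : ∀ {n} → Graph n → Set
CVertex {n} G = Fin n ⊎ EdgeOf G

CAdj : ∀ {n} (G : Graph n) → CVertex G → CVertex G → Set
CAdj G (inj₁ u) (inj₁ v) = u ≢ v × ¬ Adj G u v
CAdj G (inj₁ u) (inj₂ (i , j , _)) = u ≡ i ⊎ u ≡ j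
CAdj G (inj₂ (i , j , _)) (inj₁ u) = u ≡ i ⊎ u ≡ j
CAdj G (inj₂ _) (inj₂ _) = ⊥

-- A total dominator coloring of a graph (V, E) with exactly k (nonempty)
-- color classes: a surjective proper coloring c : V → Fin k such that every
-- vertex is adjacent to all vertices of some color class.
record TDC {V : Set} (E : V → V → Set) (k : ℕ) : Set where
  field
    col       : V → Fin k
    onto      : Surjective _≡_ _≡_ col
    proper    : ∀ u v → E u v → col u ≢ col v
    dominates : ∀ v → ∃ λ (i : Fin k) → ∀ u → col u ≡ i → E v u

module Submission where

open import Defs
open import Algebra.Properties.CommutativeMonoid.Sum as Sum using ()
open import Data.Bool using (T)
open import Data.Bool.Properties using (T?; T-irrelevant)
open import Data.Empty using (⊥-elim)
open import Data.Fin using (Fin; zero; suc; toℕ; fromℕ<; punchIn; punchOut; join; splitAt)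
open import Data.Fin.Properties
  using ( any?; all?; toℕ-injective; toℕ-fromℕ<; toℕ≤pred[n]; injective⇒≤; splitAt-join
        ; punchOut-injective; punchInᵢ≢i; punchIn-injective; punchIn-punchOut )
  renaming (_≟_ to _≟ᶠ_)
open import Data.Nat
  using (ℕ; zero; suc; _≤_; _<_; _+_; _*_; _/_; _⊓_; ⌊_/2⌋; ⌈_/2⌉; z≤n; s≤s; _<?_; _≤?_)
open import Data.Nat.DivMod using (m/n*n≤m)
open import Data.Nat.Properties
open import Data.Nat.Tactic.RingSolver using (solve-∀)
open import Data.Product using (Σ; ∃; _×_; _,_; proj₁; proj₂)
import Data.Product
open import Data.Sum using (_⊎_; inj₁; inj₂; [_,_])
import Data.Sum
open import Data.Sum.Properties using (inj₁-injective; inj₂-injective)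
open import Function using (_∘_; id; case_of_)
open import Function.Bundles using (_⇔_; mk⇔; Equivalence)
open import Function.Definitions using (Injective; Surjective)
open import Function.Properties.Equivalence using () renaming (refl to ⇔-refl)
open import Relation.Binary.Definitions using (tri<; tri≈; tri>)
open import Relation.Binary.PropositionalEquality
  using (_≡_; _≢_; refl; sym; trans; cong; cong₂; subst; module ≡-Reasoning)
open import Relation.Nullary using (¬_; Dec; yes; no; Irrelevant)
open import Relation.Nullary.Decidable using (_×-dec_; _⊎-dec_; _→-dec_; ¬?)
open import Relation.Unary using (Decidable)

-- In a TDC of C(G) two vertices of G share a colour only if they are
-- adjacent in G, and then their class is exactly that pair: the subdivision vertex of
-- the edge must dominate a class inside its neighbourhood {u, v}. For the same reason,
-- of two adjacent vertices one has a singleton class unless they share a colour, so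
-- among three consecutive vertices of the Hamiltonian path one has a singleton class.
-- Weigh vertices with singleton classes 6 and all others 3: the path forces total
-- weight ≥ 4n − 2, while every class carries weight ≤ 6 and the class of a
-- subdivision vertex weight ≤ 3 (it holds no pair and no singleton). Hence 6k ≥ 4n + 1.
--
-- The path yields ⌈n/2⌉ edges covering V(G). Colour every vertex of G by
-- itself, except that x₁ takes the colour of x₀ for one covering edge x₀x₁; give the
-- subdivision vertex of the t-th covering edge colour t, and all other subdivision
-- vertices the freed colour x₁. Discarding unused colours gives a TDC.

open Sum +-0-commutativeMonoid
  using (sum; sum-syntax; ∑-comm; ∑-distrib-+; sum-remove; sum-cong-≗; sum-replicate-zero)

sum-≤-* : ∀ {n} {f : Fin n → ℕ} {c} → (∀ i → f i ≤ c) → sum f ≤ n * c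
sum-≤-* {zero}  _   = z≤n
sum-≤-* {suc n} f≤c = +-mono-≤ (f≤c zero) (sum-≤-* (f≤c ∘ suc))

sum-zero : ∀ {n} {f : Fin n → ℕ} → (∀ i → f i ≡ 0) → sum f ≡ 0
sum-zero {n} f≡0 = trans (sum-cong-≗ f≡0) (sum-replicate-zero n)

sum-one-point : ∀ {n} (f : Fin n → ℕ) {i} → (∀ j → j ≢ i → f j ≡ 0) → sum f ≡ f i
sum-one-point {suc n} f {i} vanish = begin
  sum f                     ≡⟨ sum-remove {i = i} f ⟩
  f i + sum (f ∘ punchIn i) ≡⟨ cong (f i +_) (sum-zero (λ j → vanish _ (punchInᵢ≢i i j))) ⟩
  f i + 0                   ≡⟨ +-identityʳ (f i) ⟩
  f i                       ∎
  where open ≡-Reasoning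

sum-two-points : ∀ {n} (f : Fin n → ℕ) {i j} → i ≢ j →
                 (∀ l → l ≢ i → l ≢ j → f l ≡ 0) → sum f ≡ f i + f j
sum-two-points {suc n} f {i} {j} i≢j vanish = begin
  sum f                               ≡⟨ sum-remove {i = i} f ⟩
  f i + sum (f ∘ punchIn i)           ≡⟨ cong (f i +_) (sum-one-point (f ∘ punchIn i) vanish′) ⟩
  f i + f (punchIn i (punchOut i≢j))  ≡⟨ cong (λ l → f i + f l) (punchIn-punchOut i≢j) ⟩
  f i + f j                           ∎
  where
  open ≡-Reasoning
  vanish′ : ∀ l → l ≢ punchOut i≢j → f (punchIn i l) ≡ 0
  vanish′ l l≢ = vanish _ (punchInᵢ≢i i l)
    (λ eq → l≢ (punchIn-injective i l _ (trans eq (sym (punchIn-punchOut i≢j)))))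

keepIf : ∀ {P : Set} → Dec P → ℕ → ℕ
keepIf (yes _) x = x
keepIf (no _)  _ = 0

keepIf-yes : ∀ {P : Set} (d : Dec P) {x} → P → keepIf d x ≡ x
keepIf-yes (yes _) _ = refl
keepIf-yes (no ¬p) p = ⊥-elim (¬p p)

keepIf-no : ∀ {P : Set} (d : Dec P) {x} → ¬ P → keepIf d x ≡ 0
keepIf-no (yes p) ¬p = ⊥-elim (¬p p)
keepIf-no (no _)  _  = refl

keepIf-≤ : ∀ {P : Set} (d : Dec P) x → keepIf d x ≤ x
keepIf-≤ (yes _) _ = ≤-refl
keepIf-≤ (no _)  _ = z≤n

Consecutive : ∀ {n} → Fin n → Fin n → Set
Consecutive i j = toℕ j ≡ suc (toℕ i)

consecutive⇒< : ∀ {n} {i j : Fin n} → Consecutive i j → toℕ i < toℕ j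
consecutive⇒< ij = ≤-reflexive (sym ij)

consecutive⇒≢ : ∀ {n} {i j : Fin n} → Consecutive i j → i ≢ j
consecutive⇒≢ ij refl = <-irrefl refl (consecutive⇒< ij)

sum-≥-along-path : ∀ {n} (r : Fin n → ℕ) → (∀ i → 3 ≤ r i) →
  (∀ {i j l} → Consecutive i j → Consecutive j l → 6 ≤ r i ⊎ 6 ≤ r j ⊎ 6 ≤ r l) →
  4 * n ≤ sum r + 2
sum-≥-along-path {0} r r≥3 _ = z≤n
sum-≥-along-path {1} r r≥3 _ = ≤-trans (n≤1+n 4) (+-monoˡ-≤ 2 (+-monoˡ-≤ 0 (r≥3 zero)))
sum-≥-along-path {2} r r≥3 _ = +-monoˡ-≤ 2 (+-mono-≤ (r≥3 zero) (+-monoˡ-≤ 0 (r≥3 (suc zero))))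
sum-≥-along-path {suc (suc (suc n))} r r≥3 three = begin
  4 * (3 + n)                         ≡⟨ *-distribˡ-+ 4 3 n ⟩
  12 + 4 * n                          ≤⟨ +-mono-≤ first-three rest ⟩
  r₀ + (r₁ + r₂) + (sum r′ + 2)       ≡⟨ regroup r₀ r₁ r₂ (sum r′) ⟩
  sum r + 2                           ∎
  where
  open ≤-Reasoning
  r₀ r₁ r₂ : ℕ
  r₀ = r zero
  r₁ = r (suc zero)
  r₂ = r (suc (suc zero))
  r′ : Fin n → ℕ
  r′ i = r (suc (suc (suc i)))
  first-three : 12 ≤ r₀ + (r₁ + r₂)
  first-three with three {zero} {suc zero} {suc (suc zero)} refl refl
  ... | inj₁ big        = +-mono-≤ big (+-mono-≤ (r≥3 _) (r≥3 _))
  ... | inj₂ (inj₁ big) = +-mono-≤ (r≥3 _) (+-mono-≤ big (r≥3 _))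
  ... | inj₂ (inj₂ big) = +-mono-≤ (r≥3 _) (+-mono-≤ (r≥3 _) big)
  rest : 4 * n ≤ sum r′ + 2
  rest = sum-≥-along-path r′ (λ i → r≥3 (suc (suc (suc i))))
           (λ ij jl → three (cong (3 +_) ij) (cong (3 +_) jl))
  regroup : ∀ a b c s → a + (b + c) + (s + 2) ≡ a + (b + (c + s)) + 2
  regroup = solve-∀

-- `a i` stands for the colour of the i-th vertex of the path, `g` for that of a subdivision vertex.
module PathColouring {n k} (a : Fin n → Fin k) (g : Fin k) where

  Isolated : Fin n → Set
  Isolated i = a i ≢ g × (∀ j → a j ≡ a i → j ≡ i)

  isolated? : ∀ i → Dec (Isolated i)
  isolated? i = ¬? (a i ≟ᶠ g) ×-dec all? (λ j → (a j ≟ᶠ a i) →-dec (j ≟ᶠ i))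

  weight : Fin n → ℕ
  weight i with isolated? i
  ... | yes _ = 6
  ... | no _  = 3

  weight-isolated : ∀ {i} → Isolated i → weight i ≡ 6
  weight-isolated {i} iso with isolated? i
  ... | yes _   = refl
  ... | no ¬iso = ⊥-elim (¬iso iso)

  weight-shared : ∀ {i} → ¬ Isolated i → weight i ≡ 3
  weight-shared {i} ¬iso with isolated? i
  ... | yes iso = ⊥-elim (¬iso iso)
  ... | no _    = refl

  weight-≥3 : ∀ i → 3 ≤ weight i
  weight-≥3 i with isolated? i
  ... | yes _ = s≤s (s≤s (s≤s z≤n))
  ... | no _  = ≤-refl

  classWeight : Fin k → ℕ
  classWeight c = ∑[ i < n ] keepIf (a i ≟ᶠ c) (weight i)

  classWeight-single : ∀ {i} → (∀ j → a j ≡ a i → j ≡ i) → classWeight (a i) ≡ weight i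
  classWeight-single {i} only-i = trans
    (sum-one-point _ λ j j≢i → keepIf-no (a j ≟ᶠ a i) (j≢i ∘ only-i j))
    (keepIf-yes (a i ≟ᶠ a i) refl)

  classWeight-pair : ∀ {i j} → i ≢ j → a j ≡ a i → (∀ l → a l ≡ a i → l ≡ i ⊎ l ≡ j) →
                     classWeight (a i) ≡ weight i + weight j
  classWeight-pair {i} {j} i≢j same only-ij = trans
    (sum-two-points _ i≢j λ l l≢i l≢j →
      keepIf-no (a l ≟ᶠ a i) λ eq → [ l≢i , l≢j ] (only-ij l eq))
    (cong₂ _+_ (keepIf-yes (a i ≟ᶠ a i) refl) (keepIf-yes (a j ≟ᶠ a i) same))

  sum-weight≡∑classWeight : sum weight ≡ ∑[ c < k ] classWeight c
  sum-weight≡∑classWeight = trans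
    (sum-cong-≗ λ i → sym (trans
      (sum-one-point (λ c → keepIf (a i ≟ᶠ c) (weight i))
                     (λ c c≢ → keepIf-no (a i ≟ᶠ c) (c≢ ∘ sym)))
      (keepIf-yes (a i ≟ᶠ a i) refl)))
    (∑-comm λ i c → keepIf (a i ≟ᶠ c) (weight i))

  module _ (pair : ∀ {i j} → i ≢ j → a i ≡ a j →
                   a i ≢ g × (∀ l → a l ≡ a i → l ≡ i ⊎ l ≡ j))
           (path : ∀ {i j} → Consecutive i j → Isolated i ⊎ Isolated j ⊎ a i ≡ a j)
           where

    isolated-among-three : ∀ {i j l} → Consecutive i j → Consecutive j l →
                           Isolated i ⊎ Isolated j ⊎ Isolated l
    isolated-among-three {i} {j} {l} ij jl with path ij | path jl
    ... | inj₁ iso        | _                = inj₁ iso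
    ... | inj₂ (inj₁ iso) | _                = inj₂ (inj₁ iso)
    ... | inj₂ (inj₂ _)   | inj₁ iso         = inj₂ (inj₁ iso)
    ... | inj₂ (inj₂ _)   | inj₂ (inj₁ iso)  = inj₂ (inj₂ iso)
    ... | inj₂ (inj₂ a≡₁) | inj₂ (inj₂ a≡₂)
      with proj₂ (pair (consecutive⇒≢ ij) a≡₁) l (sym (trans a≡₁ a≡₂))
    ... | inj₁ refl = ⊥-elim (<-asym (consecutive⇒< ij) (consecutive⇒< jl))
    ... | inj₂ refl = ⊥-elim (consecutive⇒≢ jl refl)

    class-capacity : ∀ c → classWeight c + keepIf (c ≟ᶠ g) 3 ≤ 6
    class-capacity c with any? (λ i → a i ≟ᶠ c)
    ... | no empty = begin
      classWeight c + keepIf (c ≟ᶠ g) 3 ≡⟨ cong (_+ _) (sum-zero λ i → keepIf-no (a i ≟ᶠ c) (empty ∘ (i ,_))) ⟩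
      keepIf (c ≟ᶠ g) 3                 ≤⟨ keepIf-≤ (c ≟ᶠ g) 3 ⟩
      3                                 ≤⟨ m≤m+n 3 3 ⟩
      6                                 ∎
      where open ≤-Reasoning
    ... | yes (i , refl) with isolated? i
    ... | yes iso@(a≢g , only-i) = ≤-reflexive (cong₂ _+_
            (trans (classWeight-single only-i) (weight-isolated iso))
            (keepIf-no (a i ≟ᶠ g) a≢g))
    ... | no ¬iso with any? (λ j → ¬? (j ≟ᶠ i) ×-dec (a j ≟ᶠ a i))
    ... | yes (j , j≢i , same) = ≤-reflexive (cong₂ _+_
            (trans (classWeight-pair (j≢i ∘ sym) same only-ij)
                   (cong₂ _+_ (weight-shared ¬iso) (weight-shared ¬iso-j)))
            (keepIf-no (a i ≟ᶠ g) a≢g))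
      where
      a≢g : a i ≢ g
      a≢g = proj₁ (pair (j≢i ∘ sym) (sym same))
      only-ij : ∀ l → a l ≡ a i → l ≡ i ⊎ l ≡ j
      only-ij = proj₂ (pair (j≢i ∘ sym) (sym same))
      ¬iso-j : ¬ Isolated j
      ¬iso-j (_ , only-j) = j≢i (sym (only-j i (sym same)))
    ... | no alone = +-mono-≤
            (≤-reflexive (trans (classWeight-single only-i) (weight-shared ¬iso)))
            (keepIf-≤ (a i ≟ᶠ g) 3)
      where
      only-i : ∀ j → a j ≡ a i → j ≡ i
      only-i j same with j ≟ᶠ i
      ... | yes j≡i = j≡i
      ... | no j≢i  = ⊥-elim (alone (j , j≢i , same))

    path-colouring-bound : 4 * n + 1 ≤ 6 * k
    path-colouring-bound = begin
      4 * n + 1                                   ≤⟨ +-monoˡ-≤ 1 along-path ⟩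
      sum weight + 2 + 1                          ≡⟨ +-assoc (sum weight) 2 1 ⟩
      sum weight + 3                              ≡⟨ cong₂ _+_ sum-weight≡∑classWeight (sym extra) ⟩
      ∑[ c < k ] classWeight c + ∑[ c < k ] keepIf (c ≟ᶠ g) 3
                                                  ≡⟨ ∑-distrib-+ classWeight (λ c → keepIf (c ≟ᶠ g) 3) ⟨
      ∑[ c < k ] (classWeight c + keepIf (c ≟ᶠ g) 3)
                                                  ≤⟨ sum-≤-* class-capacity ⟩
      k * 6                                       ≡⟨ *-comm k 6 ⟩
      6 * k                                       ∎
      where
      open ≤-Reasoning
      heavy : ∀ {i} → Isolated i → 6 ≤ weight i
      heavy iso = ≤-reflexive (sym (weight-isolated iso))
      along-path : 4 * n ≤ sum weight + 2
      along-path = sum-≥-along-path weight weight-≥3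
        (λ ij jl → Data.Sum.map heavy (Data.Sum.map heavy heavy) (isolated-among-three ij jl))
      extra : ∑[ c < k ] keepIf (c ≟ᶠ g) 3 ≡ 3
      extra = trans (sum-one-point _ λ c c≢g → keepIf-no (c ≟ᶠ g) c≢g) (keepIf-yes (g ≟ᶠ g) refl)

4n+1≤6k⇒⌊2n/3⌋<k : ∀ n k → 4 * n + 1 ≤ 6 * k → 2 * n / 3 < k
4n+1≤6k⇒⌊2n/3⌋<k n k 4n+1≤6k = *-cancelˡ-< 6 (2 * n / 3) k (begin-strict
  6 * q              ≡⟨ *-assoc 2 3 q ⟩
  2 * (3 * q)        ≡⟨ cong (2 *_) (*-comm 3 q) ⟩
  2 * (q * 3)        ≤⟨ *-monoʳ-≤ 2 (m/n*n≤m (2 * n) 3) ⟩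
  2 * (2 * n)        ≡⟨ *-assoc 2 2 n ⟨
  4 * n              <⟨ m<m+n (4 * n) (s≤s z≤n) ⟩
  4 * n + 1          ≤⟨ 4n+1≤6k ⟩
  6 * k              ∎)
  where
  open ≤-Reasoning
  q : ℕ
  q = 2 * n / 3

_∈₂_ : ∀ {A : Set} → A → A × A → Set
z ∈₂ (x , y) = z ≡ x ⊎ z ≡ y

_∈₂?_ : ∀ {n} (z : Fin n) p → Dec (z ∈₂ p)
z ∈₂? (x , y) = (z ≟ᶠ x) ⊎-dec (z ≟ᶠ y)

∈₂-of-pair : ∀ {A : Set} {x y u v z : A} → u ∈₂ (x , y) → v ∈₂ (x , y) → u ≢ v →
             z ∈₂ (x , y) → z ∈₂ (u , v)
∈₂-of-pair (inj₁ refl) (inj₁ refl) u≢v _  = ⊥-elim (u≢v refl)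
∈₂-of-pair (inj₁ refl) (inj₂ refl) _   z∈ = z∈
∈₂-of-pair (inj₂ refl) (inj₁ refl) _   z∈ = Data.Sum.swap z∈
∈₂-of-pair (inj₂ refl) (inj₂ refl) u≢v _  = ⊥-elim (u≢v refl)

ends : ∀ {A : Set} {B : A → A → Set} → (Σ A λ i → Σ A (B i)) → A × A
ends (i , j , _) = i , j

Adj-sym : ∀ {n} (G : Graph n) {u v} → Adj G u v → Adj G v u
Adj-sym G {u} {v} = subst T (adj-sym G u v)

Adj⇒≢ : ∀ {n} (G : Graph n) {u v} → Adj G u v → u ≢ v
Adj⇒≢ G {u} uu refl = subst T (irrefl G u) uu

ends-distinct : ∀ {n} (G : Graph n) (e : EdgeOf G) → proj₁ (ends e) ≢ proj₂ (ends e)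
ends-distinct G (_ , _ , i<j , _) refl = <-irrefl refl i<j

Adj-on-pair : ∀ {n} (G : Graph n) {x y u v} → Adj G x y → u ∈₂ (x , y) → v ∈₂ (x , y) →
              u ≢ v → Adj G u v
Adj-on-pair G xy (inj₁ refl) (inj₁ refl) u≢v = ⊥-elim (u≢v refl)
Adj-on-pair G xy (inj₁ refl) (inj₂ refl) _   = xy
Adj-on-pair G xy (inj₂ refl) (inj₁ refl) _   = Adj-sym G xy
Adj-on-pair G xy (inj₂ refl) (inj₂ refl) u≢v = ⊥-elim (u≢v refl)

subdivision-neighbour : ∀ {n} {G : Graph n} (e : EdgeOf G) w →
                        CAdj G (inj₂ e) w → ∃ λ x → w ≡ inj₁ x × x ∈₂ ends e
subdivision-neighbour e (inj₁ x) x∈e = x , refl , x∈e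

edge-between : ∀ {n} (G : Graph n) {u v} → Adj G u v →
               Σ (EdgeOf G) λ e → ∀ x → x ∈₂ ends e ⇔ x ∈₂ (u , v)
edge-between G {u} {v} uv with <-cmp (toℕ u) (toℕ v)
... | tri< u<v _ _ = (u , v , u<v , uv) , λ _ → ⇔-refl
... | tri≈ _ u≡v _ = ⊥-elim (Adj⇒≢ G uv (toℕ-injective u≡v))
... | tri> _ _ v<u = (v , u , v<u , Adj-sym G uv) , λ _ → mk⇔ ∈₂-swap ∈₂-swap
  where
  ∈₂-swap : ∀ {A : Set} {x y z : A} → z ∈₂ (x , y) → z ∈₂ (y , x)
  ∈₂-swap = Data.Sum.swap

module CentralLowerBound {n} {G : Graph n} {k} (T : TDC (CAdj G) k) where
  open TDC T

  Pure : Fin n → Set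
  Pure u = ∀ w → col w ≡ col (inj₁ u) → w ≡ inj₁ u

  same-colour⇒adjacent : ∀ {u v} → u ≢ v → col (inj₁ u) ≡ col (inj₁ v) → Adj G u v
  same-colour⇒adjacent {u} {v} u≢v same with T? (adj G u v)
  ... | yes uv = uv
  ... | no ¬uv = ⊥-elim (proper (inj₁ u) (inj₁ v) (u≢v , ¬uv) same)

  -- The subdivision vertex of uv has neighbourhood {u, v}, and every class is nonempty.
  subdivision-dominates : ∀ {u v} → Adj G u v → Σ (Fin k) λ c →
    c ∈₂ (col (inj₁ u) , col (inj₁ v)) × (∀ w → col w ≡ c → w ∈₂ (inj₁ u , inj₁ v))
  subdivision-dominates {u} {v} uv with edge-between G uv
  ... | e , ends⇔ with dominates (inj₂ e)
  ... | c , class⊆N with onto c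
  ... | w₀ , w₀↦c = c , w₀-colour (inClass w₀ (w₀↦c refl)) , inClass
    where
    w₀-colour : w₀ ∈₂ (inj₁ u , inj₁ v) → c ∈₂ (col (inj₁ u) , col (inj₁ v))
    w₀-colour = Data.Sum.map (λ { refl → sym (w₀↦c refl) }) (λ { refl → sym (w₀↦c refl) })
    inClass : ∀ w → col w ≡ c → w ∈₂ (inj₁ u , inj₁ v)
    inClass w w↦c with subdivision-neighbour e w (class⊆N w w↦c)
    ... | x , refl , x∈e = Data.Sum.map (cong inj₁) (cong inj₁) (Equivalence.to (ends⇔ x) x∈e)

  pair-class : ∀ {u v} → u ≢ v → col (inj₁ u) ≡ col (inj₁ v) →
               ∀ w → col w ≡ col (inj₁ u) → w ∈₂ (inj₁ u , inj₁ v)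
  pair-class u≢v same w w~u with subdivision-dominates (same-colour⇒adjacent u≢v same)
  ... | _ , inj₁ refl , class = class w w~u
  ... | _ , inj₂ refl , class = class w (trans w~u same)

  adjacent⇒pure⊎same : ∀ {u v} → Adj G u v → Pure u ⊎ Pure v ⊎ col (inj₁ u) ≡ col (inj₁ v)
  adjacent⇒pure⊎same {u} {v} uv with col (inj₁ u) ≟ᶠ col (inj₁ v)
  ... | yes same = inj₂ (inj₂ same)
  ... | no differ with subdivision-dominates uv
  ... | _ , inj₁ refl , class =
    inj₁ λ w w~u → [ id , (λ { refl → ⊥-elim (differ (sym w~u)) }) ] (class w w~u)
  ... | _ , inj₂ refl , class =
    inj₂ (inj₁ λ w w~v → [ (λ { refl → ⊥-elim (differ w~v) }) , id ] (class w w~v))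

  lower-bound : EdgeOf G → HasHamiltonianPath G → 4 * n + 1 ≤ 6 * k
  lower-bound e₀ (p , p-inj , p-adj) = PathColouring.path-colouring-bound a g pair path
    where
    a : Fin n → Fin k
    a i = col (inj₁ (p i))
    g : Fin k
    g = col (inj₂ e₀)
    open PathColouring a g using (Isolated)

    pair : ∀ {i j} → i ≢ j → a i ≡ a j → a i ≢ g × (∀ l → a l ≡ a i → l ≡ i ⊎ l ≡ j)
    pair {i} {j} i≢j same =
      (λ a≡g → [ (λ ()) , (λ ()) ] (class (inj₂ e₀) (sym a≡g))) ,
      (λ l l~i → Data.Sum.map (p-inj ∘ inj₁-injective) (p-inj ∘ inj₁-injective)
                              (class (inj₁ (p l)) l~i))
      where
      class : ∀ w → col w ≡ a i → w ∈₂ (inj₁ (p i) , inj₁ (p j))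
      class = pair-class (i≢j ∘ p-inj) same

    pure⇒isolated : ∀ {i} → Pure (p i) → Isolated i
    pure⇒isolated pure = (λ a≡g → case pure (inj₂ e₀) (sym a≡g) of λ ()) ,
                         λ j same → p-inj (inj₁-injective (pure (inj₁ (p j)) same))

    path : ∀ {i j} → Consecutive i j → Isolated i ⊎ Isolated j ⊎ a i ≡ a j
    path {i} {j} ij = Data.Sum.map pure⇒isolated (Data.Sum.map pure⇒isolated id)
                        (adjacent⇒pure⊎same (p-adj i j ij))

Exhaustible : Set → Set₁
Exhaustible A = ∀ {P : A → Set} → Decidable P → Dec (∃ P)

Σ-exhaustible : ∀ {A : Set} {B : A → Set} → Exhaustible A → (∀ a → Exhaustible (B a)) →
                Exhaustible (Σ A B)
Σ-exhaustible searchA searchB P? with searchA (λ a → searchB a (λ b → P? (a , b)))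
... | yes (a , b , pab) = yes ((a , b) , pab)
... | no none           = no λ { ((a , b) , pab) → none (a , b , pab) }

⊎-exhaustible : ∀ {A B : Set} → Exhaustible A → Exhaustible B → Exhaustible (A ⊎ B)
⊎-exhaustible searchA searchB P? with searchA (P? ∘ inj₁) | searchB (P? ∘ inj₂)
... | yes (a , pa) | _            = yes (inj₁ a , pa)
... | no _         | yes (b , pb) = yes (inj₂ b , pb)
... | no noA       | no noB       =
  no λ { (inj₁ a , pa) → noA (a , pa) ; (inj₂ b , pb) → noB (b , pb) }

irrelevant-exhaustible : ∀ {A : Set} → Dec A → Irrelevant A → Exhaustible A
irrelevant-exhaustible (no ¬a) _ _ = no (¬a ∘ proj₁)
irrelevant-exhaustible {A} (yes a) irr {P} P? with P? a
... | yes pa = yes (a , pa)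
... | no ¬pa = no λ { (a′ , pa′) → ¬pa (subst P (irr a′ a) pa′) }

CVertex-exhaustible : ∀ {n} (G : Graph n) → Exhaustible (CVertex G)
CVertex-exhaustible G =
  ⊎-exhaustible any? (Σ-exhaustible any? λ i → Σ-exhaustible any? λ j →
    Σ-exhaustible (irrelevant-exhaustible (toℕ i <? toℕ j) <-irrelevant) λ _ →
      irrelevant-exhaustible (T? (adj G i j)) T-irrelevant)

-- Unlike `TDC`, colours may be unused; a vertex names a member of the class it dominates.
record TDCInto {V : Set} (E : V → V → Set) (C : Set) : Set where
  field
    col       : V → C
    proper    : ∀ u v → E u v → col u ≢ col v
    dominates : ∀ v → ∃ λ w → ∀ u → col u ≡ col w → E v u

module _ {V : Set} {E : V → V → Set} where

  TDCInto-map : ∀ {A B : Set} (f : A → B) → Injective _≡_ _≡_ f → TDCInto E A → TDCInto E B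
  TDCInto-map f f-inj T = record
    { col       = f ∘ col
    ; proper    = λ u v uv → proper u v uv ∘ f-inj
    ; dominates = λ v → let w , class = dominates v in w , λ u → class u ∘ f-inj
    }
    where open TDCInto T

  TDCInto-onto⇒TDC : ∀ {k} (T : TDCInto E (Fin k)) → Surjective _≡_ _≡_ (TDCInto.col T) →
                     TDC E k
  TDCInto-onto⇒TDC T onto = record
    { col       = col
    ; onto      = onto
    ; proper    = proper
    ; dominates = λ v → let w , class = dominates v in col w , class
    }
    where open TDCInto T

  drop-colour : ∀ {k} (T : TDCInto E (Fin (suc k))) c → (∀ v → TDCInto.col T v ≢ c) →
                TDCInto E (Fin k)
  drop-colour T c unused = record
    { col       = λ v → punchOut (avoids v)
    ; proper    = λ u v uv → proper u v uv ∘ punchOut-injective (avoids u) (avoids v)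
    ; dominates = λ v → let w , class = dominates v in
                        w , λ u → class u ∘ punchOut-injective (avoids u) (avoids w)
    }
    where
    open TDCInto T
    avoids : ∀ v → c ≢ col v
    avoids v = unused v ∘ sym

drop-unused-colours : ∀ {V : Set} {E : V → V → Set} → Exhaustible V →
                      ∀ {K} → TDCInto E (Fin K) → Σ ℕ λ k → k ≤ K × TDC E k
drop-unused-colours search {K} T with any? (λ c → ¬? (search (λ v → TDCInto.col T v ≟ᶠ c)))
... | no all-used = K , ≤-refl , TDCInto-onto⇒TDC T onto
  where
  onto : Surjective _≡_ _≡_ (TDCInto.col T)
  onto c with search (λ v → TDCInto.col T v ≟ᶠ c)
  ... | yes (v , v↦c) = v , λ { refl → v↦c }
  ... | no unused     = ⊥-elim (all-used (c , unused))
drop-unused-colours search {suc K} T | yes (c , unused) =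
  Data.Product.map₂ (Data.Product.map₁ m≤n⇒m≤1+n)
    (drop-unused-colours search (drop-colour T c λ v v↦c → unused (v , v↦c)))

record EdgeCover {n} (G : Graph n) (h : ℕ) : Set where
  field
    endpoints : Fin h → Fin n × Fin n
    adjacent  : ∀ t → Adj G (proj₁ (endpoints t)) (proj₂ (endpoints t))
    covers    : ∀ v → ∃ λ t → v ∈₂ endpoints t

module EdgeCoverColouring {n h} {G : Graph n} (cover : EdgeCover G h) (t₀ : Fin h) where
  open EdgeCover cover

  x₀ x₁ : Fin n
  x₀ = proj₁ (endpoints t₀)
  x₁ = proj₂ (endpoints t₀)

  x₀≢x₁ : x₀ ≢ x₁
  x₀≢x₁ = Adj⇒≢ G (adjacent t₀)

  merge : Fin n → Fin n
  merge v with v ≟ᶠ x₁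
  ... | yes _ = x₀
  ... | no _  = v

  merge-cases : ∀ v → (v ≡ x₁ × merge v ≡ x₀) ⊎ (v ≢ x₁ × merge v ≡ v)
  merge-cases v with v ≟ᶠ x₁
  ... | yes v≡x₁ = inj₁ (v≡x₁ , refl)
  ... | no v≢x₁  = inj₂ (v≢x₁ , refl)

  merge≢x₁ : ∀ v → merge v ≢ x₁
  merge≢x₁ v with merge-cases v
  ... | inj₁ (_ , eq)    = x₀≢x₁ ∘ trans (sym eq)
  ... | inj₂ (v≢x₁ , eq) = v≢x₁ ∘ trans (sym eq)

  merge-fibre : ∀ {u v} → merge u ≡ merge v → u ≡ v ⊎ (u ∈₂ (x₀ , x₁) × v ∈₂ (x₀ , x₁))
  merge-fibre {u} {v} same with merge-cases u | merge-cases v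
  ... | inj₁ (refl , _)  | inj₁ (refl , _)  = inj₁ refl
  ... | inj₁ (refl , eu) | inj₂ (_ , ev)    =
    inj₂ (inj₂ refl , inj₁ (trans (sym ev) (trans (sym same) eu)))
  ... | inj₂ (_ , eu)    | inj₁ (refl , ev) =
    inj₂ (inj₁ (trans (sym eu) (trans same ev)) , inj₂ refl)
  ... | inj₂ (_ , eu)    | inj₂ (_ , ev)    = inj₁ (trans (sym eu) (trans same ev))

  Covers : Fin h → Fin n × Fin n → Set
  Covers t (i , j) = i ∈₂ endpoints t × j ∈₂ endpoints t

  covered? : ∀ ij → Dec (∃ λ t → Covers t ij)
  covered? (i , j) = any? λ t → (i ∈₂? endpoints t) ×-dec (j ∈₂? endpoints t)

  edgeColour : ∀ {ij} → Dec (∃ λ t → Covers t ij) → Fin n ⊎ Fin h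
  edgeColour (yes (t , _)) = inj₂ t
  edgeColour (no _)        = inj₁ x₁

  colour : CVertex G → Fin n ⊎ Fin h
  colour (inj₁ v) = inj₁ (merge v)
  colour (inj₂ e) = edgeColour (covered? (ends e))

  edgeColour-cases : ∀ e → (∃ λ t → colour (inj₂ e) ≡ inj₂ t × Covers t (ends e)) ⊎
                           (colour (inj₂ e) ≡ inj₁ x₁ × ¬ ∃ λ t → Covers t (ends e))
  edgeColour-cases e with covered? (ends e)
  ... | yes (t , covered) = inj₁ (t , refl , covered)
  ... | no uncovered      = inj₂ (refl , uncovered)

  vertex≢edge : ∀ v e → colour (inj₁ v) ≢ colour (inj₂ e)
  vertex≢edge v e same with edgeColour-cases e
  ... | inj₁ (_ , eq , _) = case trans same eq of λ ()
  ... | inj₂ (eq , _)     = merge≢x₁ v (inj₁-injective (trans same eq))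

  coloured-by-cover : ∀ {t} e → colour (inj₂ e) ≡ inj₂ t → Covers t (ends e)
  coloured-by-cover e eq with edgeColour-cases e
  ... | inj₁ (_ , eq′ , covered) with inj₂-injective (trans (sym eq) eq′)
  ...   | refl = covered
  coloured-by-cover e eq | inj₂ (eq′ , _) = case trans (sym eq) eq′ of λ ()

  vertex-class : ∀ u z → colour u ≡ colour (inj₁ z) →
                 ∃ λ w → u ≡ inj₁ w × (w ≡ z ⊎ (w ∈₂ (x₀ , x₁) × z ∈₂ (x₀ , x₁)))
  vertex-class (inj₁ w) z same = w , refl , merge-fibre (inj₁-injective same)
  vertex-class (inj₂ e) z same = ⊥-elim (vertex≢edge z e (sym same))

  colour-proper : ∀ u v → CAdj G u v → colour u ≢ colour v
  colour-proper (inj₁ u) (inj₁ v) (u≢v , ¬uv) same with merge-fibre (inj₁-injective same)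
  ... | inj₁ u≡v         = u≢v u≡v
  ... | inj₂ (u∈ , v∈)   = ¬uv (Adj-on-pair G (adjacent t₀) u∈ v∈ u≢v)
  colour-proper (inj₁ u) (inj₂ e) _ = vertex≢edge u e
  colour-proper (inj₂ e) (inj₁ u) _ = vertex≢edge u e ∘ sym

  vertex-dominates : ∀ v → ∃ λ w → ∀ u → colour u ≡ colour w → CAdj G (inj₁ v) u
  vertex-dominates v with covers v
  ... | t , v∈t with edge-between G (adjacent t)
  ... | e , ends⇔ with edgeColour-cases e
  ... | inj₂ (_ , uncovered) =
    ⊥-elim (uncovered (t , Equivalence.to (ends⇔ _) (inj₁ refl) ,
                           Equivalence.to (ends⇔ _) (inj₂ refl)))
  ... | inj₁ (t′ , eq , e⊆t′) = inj₂ e , class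
    where
    v∈t′ : v ∈₂ endpoints t′
    v∈t′ = [ (λ { refl → proj₁ e⊆t′ }) , (λ { refl → proj₂ e⊆t′ }) ]
             (Equivalence.from (ends⇔ v) v∈t)
    class : ∀ u → colour u ≡ colour (inj₂ e) → CAdj G (inj₁ v) u
    class (inj₁ w)  same = ⊥-elim (vertex≢edge w e same)
    class (inj₂ e′) same = let i∈ , j∈ = coloured-by-cover e′ (trans same eq) in
                           ∈₂-of-pair i∈ j∈ (ends-distinct G e′) v∈t′

  edge-dominates : ∀ e → ∃ λ w → ∀ u → colour u ≡ colour w → CAdj G (inj₂ e) u
  edge-dominates e@(i , j , _) with j ∈₂? (x₀ , x₁)
  ... | no j∉ = inj₁ j , class
    where
    class : ∀ u → colour u ≡ colour (inj₁ j) → CAdj G (inj₂ e) u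
    class u same with vertex-class u j same
    ... | _ , refl , inj₁ refl       = inj₂ refl
    ... | _ , refl , inj₂ (_ , j∈)   = ⊥-elim (j∉ j∈)
  ... | yes j∈ = inj₁ i , class
    where
    class : ∀ u → colour u ≡ colour (inj₁ i) → CAdj G (inj₂ e) u
    class u same with vertex-class u i same
    ... | _ , refl , inj₁ refl       = inj₁ refl
    ... | _ , refl , inj₂ (w∈ , i∈)  = ∈₂-of-pair i∈ j∈ (ends-distinct G e) w∈

  tdc : TDCInto (CAdj G) (Fin n ⊎ Fin h)
  tdc = record
    { col       = colour
    ; proper    = colour-proper
    ; dominates = λ { (inj₁ v) → vertex-dominates v ; (inj₂ e) → edge-dominates e }
    }

edge-cover-bound : ∀ {n h} {G : Graph n} → EdgeCover G h → Fin h →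
                   Σ ℕ λ k → k ≤ n + h × TDC (CAdj G) k
edge-cover-bound {n} {h} {G} cover t₀ = drop-unused-colours (CVertex-exhaustible G)
  (TDCInto-map (join n h) join-injective (EdgeCoverColouring.tdc cover t₀))
  where
  join-injective : Injective _≡_ _≡_ (join n h)
  join-injective {x} {y} eq =
    trans (sym (splitAt-join n h x)) (trans (cong (splitAt n) eq) (splitAt-join n h y))

injective⇒surjective : ∀ {n} {f : Fin n → Fin n} → Injective _≡_ _≡_ f → ∀ v → ∃ λ i → f i ≡ v
injective⇒surjective {suc n} {f} f-inj v with any? (λ i → f i ≟ᶠ v)
... | yes hit  = hit
... | no  miss = ⊥-elim (<-irrefl refl (injective⇒≤ f′-inj))
  where
  avoids : ∀ i → v ≢ f i
  avoids i = miss ∘ (i ,_) ∘ sym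
  f′ : Fin (suc n) → Fin n
  f′ i = punchOut (avoids i)
  f′-inj : Injective _≡_ _≡_ f′
  f′-inj = f-inj ∘ punchOut-injective (avoids _) (avoids _)

parity : ∀ i → i ≡ 2 * ⌊ i /2⌋ ⊎ i ≡ suc (2 * ⌊ i /2⌋)
parity 0 = inj₁ refl
parity 1 = inj₂ refl
parity (suc (suc i)) with parity i
... | inj₁ even = inj₁ (trans (cong (2 +_) even) (sym (*-suc 2 ⌊ i /2⌋)))
... | inj₂ odd  = inj₂ (trans (cong (2 +_) odd) (cong suc (sym (*-suc 2 ⌊ i /2⌋))))

-- Positions 0 … m+1 of a path are covered by the pairs (s, s+1) with s = min(2t, m).
pair-start : ∀ m i → i ≤ suc m → i ≡ 2 * ⌊ i /2⌋ ⊓ m ⊎ i ≡ suc (2 * ⌊ i /2⌋ ⊓ m)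
pair-start m i i≤1+m with parity i | 2 * ⌊ i /2⌋ ≤? m
... | inj₁ even | yes 2q≤m = inj₁ (trans even (sym (m≤n⇒m⊓n≡m 2q≤m)))
... | inj₁ even | no  2q≰m = inj₂ (begin-equality
  i                     ≡⟨ ≤-antisym i≤1+m (subst (suc m ≤_) (sym even) (≰⇒> 2q≰m)) ⟩
  suc m                 ≡⟨ cong suc (sym (m≥n⇒m⊓n≡n (≤-pred (≤-trans (≰⇒> 2q≰m) (n≤1+n _))))) ⟩
  suc (2 * ⌊ i /2⌋ ⊓ m) ∎)
  where open ≤-Reasoning
... | inj₂ odd  | yes 2q≤m = inj₂ (trans odd (cong suc (sym (m≤n⇒m⊓n≡m 2q≤m))))
... | inj₂ odd  | no  2q≰m = ⊥-elim (2q≰m (≤-pred (subst (_≤ suc m) odd i≤1+m)))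

path-edge-cover : ∀ {m} {G : Graph (suc (suc m))} → HasHamiltonianPath G →
                  EdgeCover G ⌈ suc (suc m) /2⌉
path-edge-cover {m} {G} (p , p-inj , p-adj) = record
  { endpoints = λ t → p (first t) , p (second t)
  ; adjacent  = λ t → p-adj (first t) (second t) (trans (toℕ-second t) (cong suc (sym (toℕ-first t))))
  ; covers    = covers
  }
  where
  start : Fin ⌈ suc (suc m) /2⌉ → ℕ
  start t = 2 * toℕ t ⊓ m

  first second : Fin ⌈ suc (suc m) /2⌉ → Fin (suc (suc m))
  first t  = fromℕ< (s≤s (m≤n⇒m≤1+n (m⊓n≤n (2 * toℕ t) m)))
  second t = fromℕ< (s≤s (s≤s (m⊓n≤n (2 * toℕ t) m)))

  toℕ-first : ∀ t → toℕ (first t) ≡ start t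
  toℕ-first t = toℕ-fromℕ< (s≤s (m≤n⇒m≤1+n (m⊓n≤n (2 * toℕ t) m)))

  toℕ-second : ∀ t → toℕ (second t) ≡ suc (start t)
  toℕ-second t = toℕ-fromℕ< (s≤s (s≤s (m⊓n≤n (2 * toℕ t) m)))

  covers : ∀ v → ∃ λ t → v ∈₂ (p (first t) , p (second t))
  covers v with injective⇒surjective p-inj v
  ... | i , refl = t , Data.Sum.map (cong p ∘ toℕ-injective ∘ at-first)
                                    (cong p ∘ toℕ-injective ∘ at-second)
                                    (pair-start m (toℕ i) (toℕ≤pred[n] i))
    where
    t-bound : ⌊ toℕ i /2⌋ < ⌈ suc (suc m) /2⌉
    t-bound = s≤s (⌊n/2⌋-mono (toℕ≤pred[n] i))
    t : Fin ⌈ suc (suc m) /2⌉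
    t = fromℕ< t-bound
    start-t : 2 * ⌊ toℕ i /2⌋ ⊓ m ≡ start t
    start-t = cong (λ q → 2 * q ⊓ m) (sym (toℕ-fromℕ< t-bound))
    at-first : toℕ i ≡ 2 * ⌊ toℕ i /2⌋ ⊓ m → toℕ i ≡ toℕ (first t)
    at-first eq = trans eq (trans start-t (sym (toℕ-first t)))
    at-second : toℕ i ≡ suc (2 * ⌊ toℕ i /2⌋ ⊓ m) → toℕ i ≡ toℕ (second t)
    at-second eq = trans eq (trans (cong suc start-t) (sym (toℕ-second t)))

theorem2p2 : (n : ℕ) → 2 ≤ n → (G : Graph n) → HasHamiltonianPath G →
    (Σ ℕ λ k → k ≤ n + ⌈ n /2⌉ × TDC (CAdj G) k) ×
    (∀ k → TDC (CAdj G) k → suc ((2 * n) / 3) ≤ k)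
theorem2p2 (suc (suc m)) _ G path = edge-cover-bound cover zero , lower
  where
  cover : EdgeCover G ⌈ suc (suc m) /2⌉
  cover = path-edge-cover path
  e₀ : EdgeOf G
  e₀ = proj₁ (edge-between G (EdgeCover.adjacent cover zero))
  lower : ∀ k → TDC (CAdj G) k → suc (2 * suc (suc m) / 3) ≤ k
  lower k T = 4n+1≤6k⇒⌊2n/3⌋<k (suc (suc m)) k (CentralLowerBound.lower-bound T e₀ path)
theorem2p2 1 (s≤s ()) _ _
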